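{- If $S$ is a numerical semigroup of maximal embedding dimension, then $S^{(2)}=\widetilde{\widetilde{S}}$ is also a numerical semigroup.
   Context: $\mathbb{N}=\{0,1,2,\dots\}$. A numerical set is a subset $S\subseteq\mathbb{N}$ with $0\in S$ and $\mathbb{N}\setminus S$ finite. Its gaps are the elements of $\mathbb{N}\setminus S$, and $F(S)$ is its largest gap. A numerical semigroup is a numerical set closed under addition. - $m(S)$ is the smallest positive element of $S$. - For $S\neq\mathbb{N}$, the base is $B(S)=\max\{s\in S\mid s<F(S)\}$. - An atom is a positive element not expressible as a sum of two positive elements. - The embedding dimension $e(S)$ is the number of atoms, and $S$ is of maximal embedding dimension if $e(S)=m(S)$. Young diagram of $S$: it has one left-justified row for each gap $\ell$. The top row corresponds to $F(S)$, and the gaps decrease going down. The row for $\ell$ has length $|\{s\in S\mid s<\ell\}|$. This is a bijection between numerical sets and Young diagrams, with $\mathbb{N}$ corresponding to the empty diagram. The complement of a Young diagram with rows $\lambda_1\ge\dots\ge\lambda_g$ has rows $\lambda_1-\lambda_g\ge\dots\ge\lambda_1-\lambda_1$, zero rows being discarded. Geometrically, this is the rest of the $g\times\lambda_1$ rectangle rotated by $180^\circ$. The complement $\widetilde{S}$ is the numerical set whose Young diagram is the complement of that of $S$. One has $\widetilde{\mathbb{N}}=\mathbb{N}$, and for $S\neq\mathbb{N}$ equivalently $\widetilde{S}=\{B(S)-s\mid s\in S,\ s\le B(S)\}\cup\{n\mid n\ge B(S)\}$. -}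

module Defs where

open import Data.Nat using (ℕ; zero; suc; _+_; _∸_; _≤_; _<_; _≤ᵇ_)
open import Data.Nat.Properties using (≤⇒≤ᵇ)
open import Data.Bool using (Bool; true; false; if_then_else_; T)
open import Data.Maybe using (Maybe; just; nothing)
open import Data.Product using (Σ; ∃; _×_; _,_)
open import Data.List using (List; length)
open import Data.List.Membership.Propositional using (_∈_)
open import Data.List.Relation.Unary.Unique.Propositional using (Unique)
open import Function.Bundles using (_⇔_)
open import Relation.Nullary using (¬_)
open import Relation.Binary.PropositionalEquality using (_≡_; refl)

record NumericalSet : Set where
  field
    mem      : ℕ → Bool
    has0     : mem 0 ≡ true
    bound    : ℕ
    cofinite : ∀ n → bound ≤ n → mem n ≡ true

open NumericalSet public

_∈ₛ_ : ℕ → NumericalSet → Set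
n ∈ₛ S = mem S n ≡ true

lastFalse : (ℕ → Bool) → ℕ → Maybe ℕ
lastFalse p zero    = nothing
lastFalse p (suc k) = if p k then lastFalse p k else just k

lastTrue : (ℕ → Bool) → ℕ → ℕ
lastTrue p zero    = 0
lastTrue p (suc k) = if p k then k else lastTrue p k

lastTrue-true : (p : ℕ → Bool) → p 0 ≡ true → ∀ k → p (lastTrue p k) ≡ true
lastTrue-true p p0 zero = p0
lastTrue-true p p0 (suc k) with p k in eq
... | true  = eq
... | false = lastTrue-true p p0 k

-- Frobenius number F(S): the largest gap; nothing iff S = ℕ.
-- (All gaps are below bound S, so searching below bound S finds the largest one.)
frobenius : NumericalSet → Maybe ℕ
frobenius S = lastFalse (mem S) (bound S)

-- base B(S) = max { s ∈ S | s < F(S) }, given F = F(S)  (0 ∈ S, so it exists)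
baseBelow : NumericalSet → ℕ → ℕ
baseBelow S f = lastTrue (mem S) f

-- Complement: S̃ = { B - s | s ∈ S, s ≤ B } ∪ { n | n ≥ B }  for S ≠ ℕ,
-- and ℕ̃ = ℕ.

private
  T⇒≡ : ∀ {b} → T b → b ≡ true
  T⇒≡ {true} _ = refl

  memC : (ℕ → Bool) → ℕ → ℕ → Bool
  memC p b n = if b ≤ᵇ n then true else p (b ∸ n)

  memC-cof : (p : ℕ → Bool) (b n : ℕ) → b ≤ n → memC p b n ≡ true
  memC-cof p b n le with b ≤ᵇ n | ≤⇒≤ᵇ le
  ... | true | _ = refl

  memC-0 : (p : ℕ → Bool) (b : ℕ) → p b ≡ true → memC p b 0 ≡ true
  memC-0 p b pb with b ≤ᵇ 0
  ... | true  = refl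
  ... | false = pb

  complementWith : (S : NumericalSet) → Maybe ℕ → NumericalSet
  complementWith S nothing  = S
  complementWith S (just f) = record
    { mem      = memC (mem S) b
    ; has0     = memC-0 (mem S) b (lastTrue-true (mem S) (has0 S) f)
    ; bound    = b
    ; cofinite = memC-cof (mem S) b
    }
    where b = baseBelow S f

complement : NumericalSet → NumericalSet
complement S = complementWith S (frobenius S)

doubleComplement : NumericalSet → NumericalSet
doubleComplement S = complement (complement S)

IsNumericalSemigroup : NumericalSet → Set
IsNumericalSemigroup S = ∀ a b → a ∈ₛ S → b ∈ₛ S → (a + b) ∈ₛ S

IsMultiplicity : NumericalSet → ℕ → Set
IsMultiplicity S m = 0 < m × m ∈ₛ S × (∀ k → 0 < k → k < m → ¬ (k ∈ₛ S))

IsAtom : NumericalSet → ℕ → Set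
IsAtom S a = 0 < a × a ∈ₛ S ×
  ¬ (Σ ℕ λ x → Σ ℕ λ y → 0 < x × 0 < y × x ∈ₛ S × y ∈ₛ S × x + y ≡ a)

HasEmbeddingDimension : NumericalSet → ℕ → Set
HasEmbeddingDimension S e =
  Σ (List ℕ) λ l → Unique l × (∀ a → (a ∈ l) ⇔ IsAtom S a) × length l ≡ e

IsMaxEmbDim : NumericalSet → Set
IsMaxEmbDim S = Σ ℕ λ m → IsMultiplicity S m × HasEmbeddingDimension S m

-- In a semigroup of maximal embedding dimension the m atoms have pairwise distinct
-- residues modulo the multiplicity m, so every residue class contains an atom; hence
-- every positive non-atom z has z − m ∈ S, and the shifted set −m + S = {n | m + n ∈ S}
-- is closed under addition. On the other hand, if 1 ∉ S and B(S) > 0 then S̃ has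
-- Frobenius number B(S) − 1 and base B(S) − m, so that S^(2) = (−m + S) ∪ [B(S) − m, ∞)
-- (when B(S) = 0, S̃ = ℕ); adding a tail to an additively closed set keeps it closed.
module Submission where

open import Defs
open import Data.Bool using (Bool; true; false; if_then_else_; T)
open import Data.Bool.Properties using (¬-not)
open import Data.Fin using (Fin; zero; suc; toℕ; fromℕ<; punchOut)
open import Data.Fin.Properties
  using (any?; toℕ-fromℕ<; fromℕ<-injective; punchOut-injective; injective⇒≤)
open import Data.List using (List; _∷_; length; lookup)
open import Data.List.Membership.Propositional.Properties using (∈-lookup)
open import Data.List.Membership.Propositional using (_∈_)
open import Data.List.Relation.Unary.All as All using ()
open import Data.List.Relation.Unary.AllPairs using (_∷_)
open import Data.List.Relation.Unary.Unique.Propositional using (Unique)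
open import Data.Maybe using (just; nothing)
open import Data.Nat
open import Data.Nat.DivMod using (_%_; _/_; m≡m%n+[m/n]*n; m%n<n; /-monoˡ-≤)
open import Data.Nat.Properties
open import Data.Nat.Solver using (module +-*-Solver)
open import Data.Product using (∃; _×_; _,_; proj₁; proj₂)
open import Data.Sum using (_⊎_; inj₁; inj₂)
open import Data.Unit using (tt)
open import Function.Bundles using (_⇔_; Equivalence)
open import Function.Definitions using (Injective)
open import Relation.Binary.Definitions using (tri<; tri≈; tri>)
open import Relation.Binary.PropositionalEquality
open import Relation.Nullary using (¬_; yes; no; contradiction)

open ≡-Reasoning

lookup-injective : ∀ {a} {A : Set a} {xs : List A} → Unique xs → Injective _≡_ _≡_ (lookup xs)
lookup-injective {xs = _ ∷ _}  _        {zero}  {zero}  _  = refl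
lookup-injective {xs = _ ∷ xs} (x∉ ∷ _) {zero}  {suc j} eq =
  contradiction eq (All.lookup x∉ (∈-lookup {xs = xs} j))
lookup-injective {xs = _ ∷ xs} (x∉ ∷ _) {suc i} {zero}  eq =
  contradiction (sym eq) (All.lookup x∉ (∈-lookup {xs = xs} i))
lookup-injective (_ ∷ unique) {suc i} {suc j} eq = cong suc (lookup-injective unique eq)

injective-below⇒surjective : ∀ {k n} (g : Fin k → ℕ) → Injective _≡_ _≡_ g →
  (∀ i → g i < n) → k ≡ n → ∀ {r} → r < n → ∃ λ i → g i ≡ r
injective-below⇒surjective {n = suc n} g g-inj g<n refl {r} r<n with any? (λ i → g i ≟ r)
... | yes hit = hit
... | no miss = contradiction (injective⇒≤ h-inj) (<-irrefl refl)
  where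
  avoids : ∀ i → fromℕ< r<n ≢ fromℕ< (g<n i)
  avoids i eq = miss (i , (begin
    g i                     ≡⟨ toℕ-fromℕ< (g<n i) ⟨
    toℕ (fromℕ< (g<n i))    ≡⟨ cong toℕ eq ⟨
    toℕ (fromℕ< r<n)        ≡⟨ toℕ-fromℕ< r<n ⟩
    r                       ∎))

  h : Fin (suc n) → Fin n
  h i = punchOut (avoids i)

  h-inj : Injective _≡_ _≡_ h
  h-inj {i} {j} eq =
    g-inj (fromℕ<-injective _ _ (g<n i) (g<n j) (punchOut-injective (avoids i) (avoids j) eq))

≡-mod⇒+multiple : ∀ {a b} m .{{_ : NonZero m}} → a ≤ b → a % m ≡ b % m →
  ∃ λ q → b ≡ a + q * m
≡-mod⇒+multiple {a} {b} m a≤b eq = b / m ∸ a / m , (begin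
  b                                         ≡⟨ m≡m%n+[m/n]*n b m ⟩
  b % m + b / m * m                         ≡⟨ cong (_+ b / m * m) eq ⟨
  a % m + b / m * m                         ≡⟨ cong (a % m +_) (m+[n∸m]≡n a/m*m≤b/m*m) ⟨
  a % m + (a / m * m + (b / m * m ∸ a / m * m))
                                            ≡⟨ +-assoc (a % m) _ _ ⟨
  a % m + a / m * m + (b / m * m ∸ a / m * m)
    ≡⟨ cong₂ _+_ (m≡m%n+[m/n]*n a m) (*-distribʳ-∸ m (b / m) (a / m)) ⟨
  a + (b / m ∸ a / m) * m                   ∎)
  where
  a/m*m≤b/m*m : a / m * m ≤ b / m * m
  a/m*m≤b/m*m = *-monoˡ-≤ m (/-monoˡ-≤ m a≤b)

m∸[m∸n∸o]≡n+o : ∀ {m n o} → n ≤ m → o ≤ m ∸ n → m ∸ (m ∸ n ∸ o) ≡ n + o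
m∸[m∸n∸o]≡n+o {m} {n} {o} n≤m o≤m∸n = begin
  m ∸ (m ∸ n ∸ o)   ≡⟨ cong (m ∸_) (∸-+-assoc m n o) ⟩
  m ∸ (m ∸ (n + o)) ≡⟨ m∸[m∸n]≡n n+o≤m ⟩
  n + o             ∎
  where
  n+o≤m : n + o ≤ m
  n+o≤m = subst (n + o ≤_) (m+[n∸m]≡n n≤m) (+-monoʳ-≤ n o≤m∸n)

lastFalse-false : ∀ p k {g} → lastFalse p k ≡ just g → p g ≡ false
lastFalse-false p (suc k) eq with p k in pk
... | true = lastFalse-false p k eq
lastFalse-false p (suc k) refl | false = pk

lastFalse-suc : ∀ p k → p k ≡ false → lastFalse p (suc k) ≡ just k
lastFalse-suc p k pk rewrite pk = refl

lastTrue-unique : ∀ p {j k} → j < k → p j ≡ true → (∀ n → j < n → n < k → p n ≡ false) →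
  lastTrue p k ≡ j
lastTrue-unique p {j} {suc k} j<1+k pj gap with m≤n⇒m<n∨m≡n (s≤s⁻¹ j<1+k)
... | inj₂ refl rewrite pj = refl
... | inj₁ j<k rewrite gap k j<k (n<1+n k) =
  lastTrue-unique p j<k pj (λ n j<n n<k → gap n j<n (m<n⇒m<1+n n<k))

if-≤ᵇ-≥ : ∀ {A : Set} {b n} (x y : A) → b ≤ n → (if b ≤ᵇ n then x else y) ≡ x
if-≤ᵇ-≥ {b = b} {n} x y b≤n with b ≤ᵇ n | ≤⇒≤ᵇ b≤n
... | true | _ = refl

if-≤ᵇ-< : ∀ {A : Set} {b n} (x y : A) → n < b → (if b ≤ᵇ n then x else y) ≡ y
if-≤ᵇ-< {b = b} {n} x y n<b with b ≤ᵇ n in b≤ᵇn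
... | false = refl
... | true = contradiction (≤ᵇ⇒≤ b n (subst T (sym b≤ᵇn) tt)) (<⇒≱ n<b)

-- The membership function of Defs.complement, where it is private.
reflect : (ℕ → Bool) → ℕ → ℕ → Bool
reflect p b n = if b ≤ᵇ n then true else p (b ∸ n)

complement-ℕ : ∀ X → frobenius X ≡ nothing → complement X ≡ X
complement-ℕ X frob with frobenius X
complement-ℕ X refl | nothing = refl

doubleComplement-ℕ : ∀ X → frobenius X ≡ nothing → doubleComplement X ≡ X
doubleComplement-ℕ X frob = trans (cong complement (complement-ℕ X frob)) (complement-ℕ X frob)

complement-mem : ∀ X {f} → frobenius X ≡ just f →
  ∀ n → mem (complement X) n ≡ reflect (mem X) (baseBelow X f) n
complement-mem X frob n with frobenius X
complement-mem X refl n | just _ = refl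

complement-bound : ∀ X {f} → frobenius X ≡ just f → bound (complement X) ≡ baseBelow X f
complement-bound X frob with frobenius X
complement-bound X refl | just _ = refl

multiplicity-≤ : ∀ {S m s} → IsMultiplicity S m → 0 < s → s ∈ₛ S → m ≤ s
multiplicity-≤ (_ , _ , minimal) 0<s s∈S = ≮⇒≥ (λ s<m → minimal _ 0<s s<m s∈S)

below-multiplicity-∉ : ∀ {S m s} → IsMultiplicity S m → 0 < s → s < m → mem S s ≡ false
below-multiplicity-∉ (_ , _ , minimal) 0<s s<m = ¬-not (minimal _ 0<s s<m)

sum-not-atom : ∀ {S a d} → 0 < a → a ∈ₛ S → 0 < d → d ∈ₛ S → ¬ IsAtom S (a + d)
sum-not-atom 0<a a∈S 0<d d∈S (_ , _ , indecomposable) =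
  indecomposable (_ , _ , 0<a , 0<d , a∈S , d∈S , refl)

1∈⇒ℕ : ∀ {S} → IsNumericalSemigroup S → 1 ∈ₛ S → ∀ n → n ∈ₛ S
1∈⇒ℕ {S} closed 1∈S zero    = has0 S
1∈⇒ℕ {S} closed 1∈S (suc n) = closed 1 n 1∈S (1∈⇒ℕ {S} closed 1∈S n)

multiplicity>1 : ∀ {S f m} → IsNumericalSemigroup S → frobenius S ≡ just f →
  IsMultiplicity S m → 1 < m
multiplicity>1 {m = suc (suc _)} _ _ _ = s≤s (s≤s z≤n)
multiplicity>1 {S} {f} {m = suc zero} closed frob (_ , 1∈S , _) =
  contradiction (trans (sym (1∈⇒ℕ {S} closed 1∈S f)) (lastFalse-false (mem S) (bound S) frob)) λ ()

module _ (X : NumericalSet) (c : ℕ) (A : ℕ → Bool)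
  (X≡ : ∀ n → mem X n ≡ (if c ≤ᵇ n then true else A n))
  where

  tail-union-∈⁻ : ∀ {n} → n ∈ₛ X → c ≤ n ⊎ A n ≡ true
  tail-union-∈⁻ {n} n∈X with c ≤? n
  ... | yes c≤n = inj₁ c≤n
  ... | no  c≰n = inj₂ (trans (sym (trans (X≡ n) (if-≤ᵇ-< true (A n) (≰⇒> c≰n)))) n∈X)

  tail-union-∈⁺ : ∀ {n} → c ≤ n ⊎ A n ≡ true → n ∈ₛ X
  tail-union-∈⁺ {n} (inj₁ c≤n) = trans (X≡ n) (if-≤ᵇ-≥ true (A n) c≤n)
  tail-union-∈⁺ {n} (inj₂ An) with c ≤? n
  ... | yes c≤n = tail-union-∈⁺ (inj₁ c≤n)
  ... | no  c≰n = trans (X≡ n) (trans (if-≤ᵇ-< true (A n) (≰⇒> c≰n)) An)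

  tail-union-closed : (∀ a b → A a ≡ true → A b ≡ true → A (a + b) ≡ true) →
    IsNumericalSemigroup X
  tail-union-closed A-closed a b a∈X b∈X =
    tail-union-∈⁺ (combine (tail-union-∈⁻ a∈X) (tail-union-∈⁻ b∈X))
    where
    combine : c ≤ a ⊎ A a ≡ true → c ≤ b ⊎ A b ≡ true → c ≤ a + b ⊎ A (a + b) ≡ true
    combine (inj₁ c≤a) _          = inj₁ (≤-trans c≤a (m≤m+n a b))
    combine (inj₂ _)   (inj₁ c≤b) = inj₁ (≤-trans c≤b (m≤n+m b a))
    combine (inj₂ Aa)  (inj₂ Ab)  = inj₂ (A-closed a b Aa Ab)

module DoubleComplement
  (S : NumericalSet) {f m : ℕ} (frob : frobenius S ≡ just f) (mult : IsMultiplicity S m)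
  (1<m : 1 < m)
  where

  private
    B : ℕ
    B = baseBelow S f

    C : NumericalSet
    C = complement S

  m≤B : ∀ {b} → B ≡ suc b → m ≤ B
  m≤B B≡1+b = multiplicity-≤ {S} mult (subst (0 <_) (sym B≡1+b) z<s) (lastTrue-true (mem S) (has0 S) f)

  B∸m<B : ∀ {b} → B ≡ suc b → B ∸ m < B
  B∸m<B B≡1+b = ∸-monoʳ-< (proj₁ mult) (m≤B B≡1+b)

  C-mem-below : ∀ {n} → n < B → mem C n ≡ mem S (B ∸ n)
  C-mem-below {n} n<B = trans (complement-mem S frob n) (if-≤ᵇ-< _ _ n<B)

  frobenius-complement-0 : B ≡ 0 → frobenius C ≡ nothing
  frobenius-complement-0 B≡0 = cong (lastFalse (mem C)) (trans (complement-bound S frob) B≡0)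

  frobenius-complement-suc : ∀ {b} → B ≡ suc b → frobenius C ≡ just b
  frobenius-complement-suc {b} B≡1+b = begin
    lastFalse (mem C) (bound C) ≡⟨ cong (lastFalse (mem C)) (trans (complement-bound S frob) B≡1+b) ⟩
    lastFalse (mem C) (suc b)   ≡⟨ lastFalse-suc (mem C) b b∉C ⟩
    just b                      ∎
    where
    b∉C : mem C b ≡ false
    b∉C = begin
      mem C b        ≡⟨ C-mem-below (subst (b <_) (sym B≡1+b) (n<1+n b)) ⟩
      mem S (B ∸ b)  ≡⟨ cong (λ x → mem S (x ∸ b)) B≡1+b ⟩
      mem S (1 + b ∸ b) ≡⟨ cong (mem S) (m+n∸n≡m 1 b) ⟩
      mem S 1        ≡⟨ below-multiplicity-∉ {S} mult z<s 1<m ⟩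
      false          ∎

  base-complement : ∀ {b} → B ≡ suc b → baseBelow C b ≡ B ∸ m
  base-complement {b} B≡1+b = lastTrue-unique (mem C) B∸m<b B∸m∈C gap
    where
    B∸m<b : B ∸ m < b
    B∸m<b = subst (B ∸ m <_) (cong (_∸ 1) B≡1+b) (∸-monoʳ-< 1<m (m≤B B≡1+b))

    B∸m∈C : mem C (B ∸ m) ≡ true
    B∸m∈C = begin
      mem C (B ∸ m)        ≡⟨ C-mem-below (B∸m<B B≡1+b) ⟩
      mem S (B ∸ (B ∸ m))  ≡⟨ cong (mem S) (m∸[m∸n]≡n (m≤B B≡1+b)) ⟩
      mem S m              ≡⟨ proj₁ (proj₂ mult) ⟩
      true                 ∎

    gap : ∀ n → B ∸ m < n → n < b → mem C n ≡ false
    gap n B∸m<n n<b = begin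
      mem C n        ≡⟨ C-mem-below n<B ⟩
      mem S (B ∸ n)  ≡⟨ below-multiplicity-∉ {S} mult (m<n⇒0<n∸m n<B) B∸n<m ⟩
      false          ∎
      where
      n<B : n < B
      n<B = subst (n <_) (sym B≡1+b) (m<n⇒m<1+n n<b)

      B∸n<m : B ∸ n < m
      B∸n<m = subst (B ∸ n <_) (m∸[m∸n]≡n (m≤B B≡1+b)) (∸-monoʳ-< B∸m<n (<⇒≤ n<B))

  doubleComplement-mem-0 : B ≡ 0 → ∀ n →
    mem (doubleComplement S) n ≡ (if B ∸ m ≤ᵇ n then true else mem S (m + n))
  doubleComplement-mem-0 B≡0 n = begin
    mem (doubleComplement S) n  ≡⟨ cong (λ X → mem X n) (complement-ℕ C (frobenius-complement-0 B≡0)) ⟩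
    mem C n                     ≡⟨ complement-mem S frob n ⟩
    reflect (mem S) B n         ≡⟨ if-≤ᵇ-≥ _ _ B≤n ⟩
    true                        ≡⟨ if-≤ᵇ-≥ _ _ (≤-trans (m∸n≤m B m) B≤n) ⟨
    (if B ∸ m ≤ᵇ n then true else mem S (m + n)) ∎
    where
    B≤n : B ≤ n
    B≤n = subst (_≤ n) (sym B≡0) z≤n

  doubleComplement-reflect : ∀ {b} → B ≡ suc b → ∀ n →
    mem (doubleComplement S) n ≡ reflect (mem C) (B ∸ m) n
  doubleComplement-reflect B≡1+b n =
    trans (complement-mem C (frobenius-complement-suc B≡1+b) n)
          (cong (λ x → reflect (mem C) x n) (base-complement B≡1+b))

  doubleComplement-mem-suc : ∀ {b} → B ≡ suc b → ∀ n →
    mem (doubleComplement S) n ≡ (if B ∸ m ≤ᵇ n then true else mem S (m + n))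
  doubleComplement-mem-suc {b} B≡1+b n with B ∸ m ≤? n
  ... | yes B∸m≤n = begin
    mem (doubleComplement S) n  ≡⟨ doubleComplement-reflect B≡1+b n ⟩
    reflect (mem C) (B ∸ m) n   ≡⟨ if-≤ᵇ-≥ _ _ B∸m≤n ⟩
    true                        ≡⟨ if-≤ᵇ-≥ _ _ B∸m≤n ⟨
    (if B ∸ m ≤ᵇ n then true else mem S (m + n)) ∎
  ... | no B∸m≰n = begin
    mem (doubleComplement S) n  ≡⟨ doubleComplement-reflect B≡1+b n ⟩
    reflect (mem C) (B ∸ m) n   ≡⟨ if-≤ᵇ-< _ _ n<B∸m ⟩
    mem C (B ∸ m ∸ n)           ≡⟨ C-mem-below (≤-<-trans (m∸n≤m (B ∸ m) n) (B∸m<B B≡1+b)) ⟩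
    mem S (B ∸ (B ∸ m ∸ n))     ≡⟨ cong (mem S) (m∸[m∸n∸o]≡n+o (m≤B B≡1+b) (<⇒≤ n<B∸m)) ⟩
    mem S (m + n)               ≡⟨ if-≤ᵇ-< _ _ n<B∸m ⟨
    (if B ∸ m ≤ᵇ n then true else mem S (m + n)) ∎
    where
    n<B∸m : n < B ∸ m
    n<B∸m = ≰⇒> B∸m≰n

  doubleComplement-mem : ∀ n →
    mem (doubleComplement S) n ≡ (if B ∸ m ≤ᵇ n then true else mem S (m + n))
  doubleComplement-mem = by-base B refl
    where
    by-base : ∀ b → B ≡ b → ∀ n →
      mem (doubleComplement S) n ≡ (if B ∸ m ≤ᵇ n then true else mem S (m + n))
    by-base zero    B≡0   = doubleComplement-mem-0 B≡0
    by-base (suc b) B≡1+b = doubleComplement-mem-suc B≡1+b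

module MaximalEmbeddingDimension
  (S : NumericalSet) (closed : IsNumericalSemigroup S) {m : ℕ} (mult : IsMultiplicity S m)
  (atoms : List ℕ) (unique : Unique atoms) (atoms-exact : ∀ a → (a ∈ atoms) ⇔ IsAtom S a)
  (count : length atoms ≡ m)
  where

  instance
    m-nonZero : NonZero m
    m-nonZero = >-nonZero (proj₁ mult)

  0<m+ : ∀ n → 0 < m + n
  0<m+ n = ≤-trans (proj₁ mult) (m≤m+n m n)

  multiple∈ : ∀ q → (q * m) ∈ₛ S
  multiple∈ zero    = has0 S
  multiple∈ (suc q) = closed m (q * m) (proj₁ (proj₂ mult)) (multiple∈ q)

  congruent-above-not-atom : ∀ {a b} → 0 < a → a ∈ₛ S → a < b → a % m ≡ b % m → ¬ IsAtom S b
  congruent-above-not-atom {a} 0<a a∈S a<b eq with ≡-mod⇒+multiple m (<⇒≤ a<b) eq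
  ... | zero  , b≡a+0 = contradiction (trans b≡a+0 (+-identityʳ a)) (>⇒≢ a<b)
  ... | suc q , refl  = sum-not-atom {S} 0<a a∈S (0<m+ (q * m)) (multiple∈ (suc q))

  atoms-incongruent : ∀ {a b} → IsAtom S a → IsAtom S b → a % m ≡ b % m → a ≡ b
  atoms-incongruent {a} {b} a-atom@(0<a , a∈S , _) b-atom@(0<b , b∈S , _) eq with <-cmp a b
  ... | tri≈ _ a≡b _ = a≡b
  ... | tri< a<b _ _ = contradiction b-atom (congruent-above-not-atom 0<a a∈S a<b eq)
  ... | tri> _ _ b<a = contradiction a-atom (congruent-above-not-atom 0<b b∈S b<a (sym eq))

  atom-at : ∀ i → IsAtom S (lookup atoms i)
  atom-at i = Equivalence.to (atoms-exact _) (∈-lookup i)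

  residue-at-injective : Injective _≡_ _≡_ (λ i → lookup atoms i % m)
  residue-at-injective {i} {j} eq =
    lookup-injective unique (atoms-incongruent (atom-at i) (atom-at j) eq)

  atom-in-residue : ∀ z → ∃ λ c → IsAtom S c × c % m ≡ z % m
  atom-in-residue z
    with i , eq ← injective-below⇒surjective _ residue-at-injective
                    (λ i → m%n<n (lookup atoms i) m) count (m%n<n z m)
    = lookup atoms i , atom-at i , eq

  non-atom-∸m∈ : ∀ {z y} → z ∈ₛ S → 0 < z → ¬ IsAtom S z → z ≡ m + y → y ∈ₛ S
  non-atom-∸m∈ {z} {y} z∈S 0<z composite z≡m+y with atom-in-residue z
  ... | c , c-atom , c≡z with <-cmp c z
  ...   | tri≈ _ refl _ = contradiction c-atom composite
  ...   | tri> _ _ z<c = contradiction c-atom (congruent-above-not-atom 0<z z∈S z<c (sym c≡z))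
  ...   | tri< c<z _ _ with ≡-mod⇒+multiple m (<⇒≤ c<z) c≡z
  ...     | zero  , z≡c+0 = contradiction (trans z≡c+0 (+-identityʳ c)) (>⇒≢ c<z)
  ...     | suc q , z≡c+m+qm =
    subst (_∈ₛ S) (+-cancelˡ-≡ m _ _ m+[c+qm]≡m+y) (closed c (q * m) (proj₁ (proj₂ c-atom)) (multiple∈ q))
    where
    m+[c+qm]≡m+y : m + (c + q * m) ≡ m + y
    m+[c+qm]≡m+y = begin
      m + (c + q * m)  ≡⟨ +-assoc m c _ ⟨
      m + c + q * m    ≡⟨ cong (_+ q * m) (+-comm m c) ⟩
      c + m + q * m    ≡⟨ +-assoc c m _ ⟩
      c + suc q * m    ≡⟨ z≡c+m+qm ⟨
      z                ≡⟨ z≡m+y ⟩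
      m + y            ∎

  shifted-closed : ∀ a b → (m + a) ∈ₛ S → (m + b) ∈ₛ S → (m + (a + b)) ∈ₛ S
  shifted-closed a b a∈ b∈ =
    non-atom-∸m∈ (closed _ _ a∈ b∈) (≤-trans (0<m+ a) (m≤m+n _ _))
      (sum-not-atom {S} (0<m+ a) a∈ (0<m+ b) b∈) (rearrange m a b)
    where
    open +-*-Solver
    rearrange : ∀ m a b → (m + a) + (m + b) ≡ m + (m + (a + b))
    rearrange = solve 3 (λ m a b → (m :+ a) :+ (m :+ b) := m :+ (m :+ (a :+ b))) refl

corollary5p6 : (S : NumericalSet) → IsNumericalSemigroup S → IsMaxEmbDim S →
    IsNumericalSemigroup (doubleComplement S)
corollary5p6 S closed (m , mult , atoms , unique , atoms-exact , count) = by-frobenius _ refl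
  where
  open MaximalEmbeddingDimension S closed mult atoms unique atoms-exact count
  open DoubleComplement S using (doubleComplement-mem)

  by-frobenius : ∀ F → frobenius S ≡ F → IsNumericalSemigroup (doubleComplement S)
  by-frobenius nothing  frob = subst IsNumericalSemigroup (sym (doubleComplement-ℕ S frob)) closed
  by-frobenius (just f) frob =
    tail-union-closed (doubleComplement S) (baseBelow S f ∸ m) (λ n → mem S (m + n))
      (doubleComplement-mem frob mult (multiplicity>1 {S} closed frob mult)) shifted-closed
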